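{- Define $\alpha_k=\frac{1}{2^{k+2}-2}$ for $k\ge0$, and sequences $\gamma_k,\nu_k$ by $\gamma_0=0$, $\nu_0=1$ and, for $k\ge1$, \[ \gamma_k=\frac{1+\gamma_{k-1}+\alpha_{k-1}\nu_{k-1}}{2(1+\alpha_{k-1})},\qquad \nu_k=\frac{1+\nu_{k-1}}{2}+\frac{(1+\gamma_{k-1}-\nu_{k-1})\alpha_{k-1}}{2(1+\alpha_{k-1})}. \] For $k\ge0$ let $I_k=\left[\frac{\alpha_k}{1-\gamma_k},\frac{\alpha_k}{\nu_k-1}\right]$, where the right endpoint is interpreted as $+\infty$ when $\nu_k=1$ (so $I_k$ is then the half-line $[\frac{\alpha_k}{1-\gamma_k},\infty)$). Then $I_k\cap I_{k+1}$ is a non-empty interval for every $k\ge0$. -}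

module Defs where

open import Data.Nat as ℕ using (ℕ; zero; suc; _^_; _∸_)
open import Data.Integer using (+_)
open import Data.Rational using (ℚ; 0ℚ; 1ℚ; _+_; _-_; _*_; _≤_; _/_; _≟_; ≢-nonZero)
open import Data.Rational using () renaming (_÷_ to _÷ℚ_)
open import Data.Product using (_×_; _,_; proj₁; proj₂)
open import Data.Sum using (_⊎_)
open import Relation.Binary.PropositionalEquality using (_≡_)
open import Relation.Nullary using (yes; no)

-- Totalised division on ℚ (p ÷ 0 = 0). It is only ever applied to
-- nonzero denominators in the statement.
infixl 7 _÷_
_÷_ : ℚ → ℚ → ℚ
p ÷ q with q ≟ 0ℚ
... | yes _  = 0ℚ
... | no q≢0 = _÷ℚ_ p q {{≢-nonZero q≢0}}

ℕ→ℚ : ℕ → ℚ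
ℕ→ℚ n = + n / 1

2ℚ : ℚ
2ℚ = ℕ→ℚ 2

α : ℕ → ℚ
α k = 1ℚ ÷ ℕ→ℚ (2 ^ (k ℕ.+ 2) ∸ 2)

γν : ℕ → ℚ × ℚ
γν zero = 0ℚ , 1ℚ
γν (suc k) =
  ((1ℚ + g + α k * n) ÷ (2ℚ * (1ℚ + α k)))
  , ((1ℚ + n) ÷ 2ℚ + ((1ℚ + g - n) * α k) ÷ (2ℚ * (1ℚ + α k)))
  where
    g = proj₁ (γν k)
    n = proj₂ (γν k)

γ : ℕ → ℚ
γ k = proj₁ (γν k)

ν : ℕ → ℚ
ν k = proj₂ (γν k)

-- x ∈ I_k = [α_k/(1-γ_k), α_k/(ν_k-1)], right endpoint +∞ when ν_k = 1
_∈I_ : ℚ → ℕ → Set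
x ∈I k = (α k ÷ (1ℚ - γ k) ≤ x) × (ν k ≡ 1ℚ ⊎ x ≤ α k ÷ (ν k - 1ℚ))

-- The proof changes coordinates.  Writing  γ_k = 1 - α_k p_k  and
-- ν_k = 1 + α_k q_k,  the interval I_k becomes [1/p_k, 1/q_k].  Since
-- α_k = 1/D_k with  D_{k+1} = 2 D_k + 2,  consecutive step sizes satisfy
-- the scale relation  α_{k+1} · 2(1 + α_k) = α_k,  and with it the
-- recurrence for (γ, ν) becomes
--     p_{k+1} = p_k + 1 - α_k q_k,    q_{k+1} = q_k + 1 - α_k p_k,
-- starting from (p_0, q_0) = (2, 0).  By induction the pair (p_k, q_k)
-- stays admissible:  q_k ≥ 0,  p_k - q_k ≥ 2  and  α_k p_k ≤ 1.
-- Admissibility gives  q_k ≤ p_k ≤ p_{k+1}  and  q_{k+1} ≤ p_k, so the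
-- point 1/p_k lies in both [1/p_k, 1/q_k] and [1/p_{k+1}, 1/q_{k+1}].
module Submission where

open import Defs
open import Data.Nat using (ℕ; suc)
open import Data.Rational using (ℚ)
open import Data.Product using (∃-syntax; _×_)

open import Data.Nat as ℕ using (zero; _^_; _∸_; NonZero)
import Data.Nat.Properties as ℕ
import Data.Nat.Tactic.RingSolver as ℕ-Solver
import Data.Integer as ℤ
open import Data.Integer using (+_)
open import Data.Rational using (0ℚ; 1ℚ; _+_; _-_; _*_; _≤_; _<_; _/_; _≟_; mkℚ; ½; positive; nonNegative; ≢-nonZero)
import Data.Rational as Q
open import Data.Rational.Properties
open import Data.Nat.Coprimality using (1-coprimeTo)
import Data.Nat.Coprimality as Coprime
open import Data.Product using (_,_; proj₁; proj₂)
open import Data.Sum using (_⊎_; inj₁; inj₂)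
open import Data.Empty using (⊥-elim)
open import Level using (0ℓ)
open import Relation.Nullary using (yes; no)
open import Relation.Nullary.Decidable using (dec⇒maybe)
open import Relation.Binary.Definitions using (tri<; tri≈; tri>)
open import Relation.Binary.PropositionalEquality
open import Tactic.RingSolver using (solve-∀)
open import Tactic.RingSolver.Core.AlmostCommutativeRing using (AlmostCommutativeRing; fromCommutativeRing)

ℚ-ring : AlmostCommutativeRing 0ℓ 0ℓ
ℚ-ring = fromCommutativeRing +-*-commutativeRing (λ x → dec⇒maybe (0ℚ ≟ x))

ℕ→ℚ-mkℚ : ∀ n → ℕ→ℚ n ≡ mkℚ (+ n) 0 (Coprime.sym (1-coprimeTo n))
ℕ→ℚ-mkℚ n = normalize-coprime (Coprime.sym (1-coprimeTo n))

ℕ→ℚ-+ : ∀ m n → ℕ→ℚ (m ℕ.+ n) ≡ ℕ→ℚ m + ℕ→ℚ n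
ℕ→ℚ-+ m n rewrite ℕ→ℚ-mkℚ m | ℕ→ℚ-mkℚ n =
  sym (cong (_/ 1) (cong₂ ℤ._+_ (ℤ.*-identityʳ (+ m)) (ℤ.*-identityʳ (+ n))))
  where import Data.Integer.Properties as ℤ

ℕ→ℚ-pos : ∀ n .{{_ : NonZero n}} → 0ℚ < ℕ→ℚ n
ℕ→ℚ-pos n = positive⁻¹ (ℕ→ℚ n) {{normalize-pos n 1}}

D : ℕ → ℕ
D k = 2 ^ (k ℕ.+ 2) ∸ 2

-- 2^(k+2) ≥ 4, so the truncated subtraction in D is harmless.
4≤2^[k+2] : ∀ k → 4 ℕ.≤ 2 ^ (k ℕ.+ 2)
4≤2^[k+2] zero    = ℕ.≤-refl
4≤2^[k+2] (suc k) = ℕ.≤-trans (4≤2^[k+2] k) (ℕ.m≤m+n _ _)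

D-suc : ∀ k → D (suc k) ≡ D k ℕ.+ D k ℕ.+ 2
D-suc k = begin
    m ℕ.+ (m ℕ.+ 0) ∸ 2
      ≡⟨ cong (λ n → n ℕ.+ (n ℕ.+ 0) ∸ 2) (sym (ℕ.m∸n+n≡m 2≤m)) ⟩
    (x ℕ.+ 2) ℕ.+ ((x ℕ.+ 2) ℕ.+ 0) ∸ 2
      ≡⟨ cong (_∸ 2) (regroup x) ⟩
    x ℕ.+ x ℕ.+ 2 ℕ.+ 2 ∸ 2
      ≡⟨ ℕ.m+n∸n≡m (x ℕ.+ x ℕ.+ 2) 2 ⟩
    x ℕ.+ x ℕ.+ 2 ∎
  where
  open ≡-Reasoning
  m x : ℕ
  m = 2 ^ (k ℕ.+ 2)
  x = m ∸ 2
  2≤m : 2 ℕ.≤ m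
  2≤m = ℕ.≤-trans (ℕ.m≤m+n 2 2) (4≤2^[k+2] k)
  regroup : ∀ x → (x ℕ.+ 2) ℕ.+ ((x ℕ.+ 2) ℕ.+ 0) ≡ x ℕ.+ x ℕ.+ 2 ℕ.+ 2
  regroup = ℕ-Solver.solve-∀

D-nonZero : ∀ k → NonZero (D k)
D-nonZero k = ℕ.>-nonZero (ℕ.≤-trans (ℕ.n≤1+n 1) (ℕ.∸-monoˡ-≤ 2 (4≤2^[k+2] k)))

scale-step : ∀ {a a' C} → a * C ≡ 1ℚ → a' * (C + C + 2ℚ) ≡ 1ℚ → a' * (2ℚ * (1ℚ + a)) ≡ a
scale-step {a} {a'} {C} aC≡1 a'C'≡1 = begin
    a' * (2ℚ * (1ℚ + a))             ≡⟨ sym (*-identityʳ _) ⟩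
    a' * (2ℚ * (1ℚ + a)) * 1ℚ        ≡⟨ cong (a' * (2ℚ * (1ℚ + a)) *_) (sym aC≡1) ⟩
    a' * (2ℚ * (1ℚ + a)) * (a * C)   ≡⟨ regroup a a' C ⟩
    a * (a' * (C + C + 2ℚ * (a * C))) ≡⟨ cong (λ t → a * (a' * (C + C + 2ℚ * t))) aC≡1 ⟩
    a * (a' * (C + C + 2ℚ))          ≡⟨ cong (a *_) a'C'≡1 ⟩
    a * 1ℚ                           ≡⟨ *-identityʳ a ⟩
    a ∎
  where
  open ≡-Reasoning
  regroup : ∀ a a' C → a' * (2ℚ * (1ℚ + a)) * (a * C) ≡ a * (a' * (C + C + 2ℚ * (a * C)))
  regroup = solve-∀ ℚ-ring

÷-inverse : ∀ p q → q ≢ 0ℚ → (p ÷ q) * q ≡ p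
÷-inverse p q q≢0 with q ≟ 0ℚ
... | yes q≡0 = ⊥-elim (q≢0 q≡0)
... | no  q≢0′ = begin
    p * Q.1/ q * q   ≡⟨ *-assoc p _ q ⟩
    p * (Q.1/ q * q) ≡⟨ cong (p *_) (*-inverseˡ q) ⟩
    p * 1ℚ           ≡⟨ *-identityʳ p ⟩
    p ∎
  where
  open ≡-Reasoning
  instance
    q-nonZero : Q.NonZero q
    q-nonZero = ≢-nonZero q≢0′

÷-unique : ∀ {p q r} → q ≢ 0ℚ → r * q ≡ p → p ÷ q ≡ r
÷-unique {q = q} {r} q≢0 refl with q ≟ 0ℚ
... | yes q≡0 = ⊥-elim (q≢0 q≡0)
... | no  q≢0′ = begin
    r * q * Q.1/ q   ≡⟨ *-assoc r q _ ⟩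
    r * (q * Q.1/ q) ≡⟨ cong (r *_) (*-inverseʳ q) ⟩
    r * 1ℚ           ≡⟨ *-identityʳ r ⟩
    r ∎
  where
  open ≡-Reasoning
  instance
    q-nonZero : Q.NonZero q
    q-nonZero = ≢-nonZero q≢0′

-- Order facts on ℚ.  Inequalities below are proved by exhibiting the
-- difference of both sides as a sum of products of nonnegative terms.
>0⇒≢0 : ∀ {x} → 0ℚ < x → x ≢ 0ℚ
>0⇒≢0 0<x x≡0 = <⇒≢ 0<x (sym x≡0)

0≤-via : ∀ {x y} → x ≡ y → 0ℚ ≤ y → 0ℚ ≤ x
0≤-via x≡y 0≤y = subst (0ℚ ≤_) (sym x≡y) 0≤y

0≤+ : ∀ {x y} → 0ℚ ≤ x → 0ℚ ≤ y → 0ℚ ≤ x + y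
0≤+ = +-mono-≤

0≤* : ∀ {x y} → 0ℚ ≤ x → 0ℚ ≤ y → 0ℚ ≤ x * y
0≤* {x} {y} 0≤x 0≤y =
  nonNegative⁻¹ _ {{nonNeg*nonNeg⇒nonNeg x {{nonNegative 0≤x}} y {{nonNegative 0≤y}}}}

0<* : ∀ {x y} → 0ℚ < x → 0ℚ < y → 0ℚ < x * y
0<* {x} {y} 0<x 0<y = positive⁻¹ _ {{pos*pos⇒pos x {{positive 0<x}} y {{positive 0<y}}}}

0≤-cancel : ∀ {x d} → 0ℚ < d → 0ℚ ≤ x * d → 0ℚ ≤ x
0≤-cancel {x} {d} 0<d 0≤xd = *-cancelʳ-≤-pos d {{positive 0<d}} (subst (_≤ x * d) (sym (*-zeroˡ d)) 0≤xd)

0≤1 : 0ℚ ≤ 1ℚ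
0≤1 = <⇒≤ (ℕ→ℚ-pos 1)

0≤-⇒≤ : ∀ {x y} → 0ℚ ≤ y - x → x ≤ y
0≤-⇒≤ {x} {y} 0≤y-x = subst₂ _≤_ (+-identityʳ x) (x+[y-x]≡y x y) (+-monoʳ-≤ x 0≤y-x)
  where
  x+[y-x]≡y : ∀ x y → x + (y - x) ≡ y
  x+[y-x]≡y = solve-∀ ℚ-ring

inverse-pos : ∀ {a c} → 0ℚ < c → a * c ≡ 1ℚ → 0ℚ < a
inverse-pos {a} {c} 0<c ac≡1 = ≰⇒> λ a≤0 →
  <-irrefl refl (<-≤-trans (ℕ→ℚ-pos 1)
    (subst₂ _≤_ ac≡1 (*-zeroˡ c) (*-monoʳ-≤-nonNeg c {{nonNegative (<⇒≤ 0<c)}} a≤0)))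

1÷-antitone : ∀ {x y} → 0ℚ < y → y ≤ x → 1ℚ ÷ x ≤ 1ℚ ÷ y
1÷-antitone {x} {y} 0<y y≤x =
  *-cancelʳ-≤-pos (x * y) {{positive (0<* 0<x 0<y)}} (subst₂ _≤_ (sym 1/x·xy≡y) (sym 1/y·xy≡x) y≤x)
  where
  0<x : 0ℚ < x
  0<x = <-≤-trans 0<y y≤x
  cancel : ∀ u v → 0ℚ < u → (1ℚ ÷ u) * (u * v) ≡ v
  cancel u v 0<u =
    trans (sym (*-assoc (1ℚ ÷ u) u v)) (trans (cong (_* v) (÷-inverse 1ℚ u (>0⇒≢0 0<u))) (*-identityˡ v))
  1/x·xy≡y : (1ℚ ÷ x) * (x * y) ≡ y
  1/x·xy≡y = cancel x y 0<x
  1/y·xy≡x : (1ℚ ÷ y) * (x * y) ≡ x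
  1/y·xy≡x = trans (cong ((1ℚ ÷ y) *_) (*-comm x y)) (cancel y x 0<y)

÷-scaled : ∀ {a z e} → 0ℚ < a → 0ℚ < z → e ≡ a * z → a ÷ e ≡ 1ℚ ÷ z
÷-scaled {a} {z} 0<a 0<z refl = ÷-unique (>0⇒≢0 (0<* 0<a 0<z)) (begin
    (1ℚ ÷ z) * (a * z) ≡⟨ regroup (1ℚ ÷ z) a z ⟩
    a * ((1ℚ ÷ z) * z) ≡⟨ cong (a *_) (÷-inverse 1ℚ z (>0⇒≢0 0<z)) ⟩
    a * 1ℚ             ≡⟨ *-identityʳ a ⟩
    a ∎)
  where
  open ≡-Reasoning
  regroup : ∀ u a z → u * (a * z) ≡ a * (u * z)
  regroup = solve-∀ ℚ-ring

α-D : ∀ k → α k * ℕ→ℚ (D k) ≡ 1ℚ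
α-D k = ÷-inverse 1ℚ (ℕ→ℚ (D k)) (>0⇒≢0 (ℕ→ℚ-pos (D k) {{D-nonZero k}}))

α-pos : ∀ k → 0ℚ < α k
α-pos k = inverse-pos (ℕ→ℚ-pos (D k) {{D-nonZero k}}) (α-D k)

α-nonneg : ∀ k → 0ℚ ≤ α k
α-nonneg k = <⇒≤ (α-pos k)

α-scale : ∀ k → α (suc k) * (2ℚ * (1ℚ + α k)) ≡ α k
α-scale k = scale-step {α k} {α (suc k)} {ℕ→ℚ (D k)}
  (α-D k) (subst (λ c → α (suc k) * c ≡ 1ℚ) D-suc-ℚ (α-D (suc k)))
  where
  D-suc-ℚ : ℕ→ℚ (D (suc k)) ≡ ℕ→ℚ (D k) + ℕ→ℚ (D k) + 2ℚ
  D-suc-ℚ = begin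
    ℕ→ℚ (D (suc k))                  ≡⟨ cong ℕ→ℚ (D-suc k) ⟩
    ℕ→ℚ (D k ℕ.+ D k ℕ.+ 2)          ≡⟨ ℕ→ℚ-+ (D k ℕ.+ D k) 2 ⟩
    ℕ→ℚ (D k ℕ.+ D k) + 2ℚ           ≡⟨ cong (_+ 2ℚ) (ℕ→ℚ-+ (D k) (D k)) ⟩
    ℕ→ℚ (D k) + ℕ→ℚ (D k) + 2ℚ ∎
    where open ≡-Reasoning

record Admissible (a p q : ℚ) : Set where
  field
    q-nonneg : 0ℚ ≤ q
    gap      : 0ℚ ≤ p - q - 2ℚ
    ap≤1     : 0ℚ ≤ 1ℚ - a * p

module _ {a p q : ℚ} (adm : Admissible a p q) where
  open Admissible adm

  admissible-p-pos : 0ℚ < p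
  admissible-p-pos = subst (0ℚ <_) (sym (p-decomposition p q))
    (+-mono-≤-< (0≤+ gap q-nonneg) (ℕ→ℚ-pos 2))
    where
    p-decomposition : ∀ p q → p ≡ (p - q - 2ℚ) + q + 2ℚ
    p-decomposition = solve-∀ ℚ-ring

  admissible-p-q-nonneg : 0ℚ ≤ p - q
  admissible-p-q-nonneg = 0≤-via (p-q-decomposition p q) (0≤+ gap (<⇒≤ (ℕ→ℚ-pos 2)))
    where
    p-q-decomposition : ∀ p q → p - q ≡ (p - q - 2ℚ) + 2ℚ
    p-q-decomposition = solve-∀ ℚ-ring

  admissible-q≤p : q ≤ p
  admissible-q≤p = 0≤-⇒≤ admissible-p-q-nonneg

  admissible-p≤p' : 0ℚ ≤ a → p ≤ p + 1ℚ - a * q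
  admissible-p≤p' 0≤a = 0≤-⇒≤ (0≤-via (increment a p q)
    (0≤+ ap≤1 (0≤* 0≤a admissible-p-q-nonneg)))
    where
    increment : ∀ a p q → p + 1ℚ - a * q - p ≡ (1ℚ - a * p) + a * (p - q)
    increment = solve-∀ ℚ-ring

  admissible-q'≤p : 0ℚ ≤ a → q + 1ℚ - a * p ≤ p
  admissible-q'≤p 0≤a = 0≤-⇒≤ (0≤-via (slack a p q)
    (0≤+ (0≤+ gap 0≤1) (0≤* 0≤a (<⇒≤ admissible-p-pos))))
    where
    slack : ∀ a p q → p - (q + 1ℚ - a * p) ≡ (p - q - 2ℚ) + 1ℚ + a * p
    slack = solve-∀ ℚ-ring

module Step {a a' : ℚ} (0≤a : 0ℚ ≤ a) (scale : a' * (2ℚ * (1ℚ + a)) ≡ a) where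

  d-pos : 0ℚ < 2ℚ * (1ℚ + a)
  d-pos = 0<* (ℕ→ℚ-pos 2) (+-mono-<-≤ (ℕ→ℚ-pos 1) 0≤a)

  d≢0 : 2ℚ * (1ℚ + a) ≢ 0ℚ
  d≢0 = >0⇒≢0 d-pos

  descale : ∀ Y → a' * Y * (2ℚ * (1ℚ + a)) ≡ a * Y
  descale Y = begin
    a' * Y * (2ℚ * (1ℚ + a))   ≡⟨ swap a' Y (2ℚ * (1ℚ + a)) ⟩
    a' * (2ℚ * (1ℚ + a)) * Y   ≡⟨ cong (_* Y) scale ⟩
    a * Y ∎
    where
    open ≡-Reasoning
    swap : ∀ x y z → x * y * z ≡ x * z * y
    swap = solve-∀ ℚ-ring

  descale-complement : ∀ X → (1ℚ - a' * X) * (2ℚ * (1ℚ + a)) ≡ 2ℚ * (1ℚ + a) - a * X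
  descale-complement X = begin
    (1ℚ - a' * X) * (2ℚ * (1ℚ + a))         ≡⟨ expand a a' X ⟩
    2ℚ * (1ℚ + a) - a' * X * (2ℚ * (1ℚ + a)) ≡⟨ cong (2ℚ * (1ℚ + a) -_) (descale X) ⟩
    2ℚ * (1ℚ + a) - a * X ∎
    where
    open ≡-Reasoning
    expand : ∀ a a' X → (1ℚ - a' * X) * (2ℚ * (1ℚ + a)) ≡ 2ℚ * (1ℚ + a) - a' * X * (2ℚ * (1ℚ + a))
    expand = solve-∀ ℚ-ring

  next-complement : ∀ p q → (1ℚ - a' * (p + 1ℚ - a * q)) * (2ℚ * (1ℚ + a))
                            ≡ (1ℚ - a * p) + 1ℚ + a + a * (a * q)
  next-complement p q = trans (descale-complement (p + 1ℚ - a * q)) (collect a p q)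
    where
    collect : ∀ a p q → 2ℚ * (1ℚ + a) - a * (p + 1ℚ - a * q) ≡ (1ℚ - a * p) + 1ℚ + a + a * (a * q)
    collect = solve-∀ ℚ-ring

  γ-step : ∀ {p q g n} → g ≡ 1ℚ - a * p → n ≡ 1ℚ + a * q →
           (1ℚ + g + a * n) ÷ (2ℚ * (1ℚ + a)) ≡ 1ℚ - a' * (p + 1ℚ - a * q)
  γ-step {p} {q} refl refl = ÷-unique d≢0 (trans (next-complement p q) (regroup a p q))
    where
    regroup : ∀ a p q → (1ℚ - a * p) + 1ℚ + a + a * (a * q) ≡ 1ℚ + (1ℚ - a * p) + a * (1ℚ + a * q)
    regroup = solve-∀ ℚ-ring

  ν-step : ∀ {p q g n} → g ≡ 1ℚ - a * p → n ≡ 1ℚ + a * q →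
           (1ℚ + n) ÷ 2ℚ + ((1ℚ + g - n) * a) ÷ (2ℚ * (1ℚ + a)) ≡ 1ℚ + a' * (q + 1ℚ - a * p)
  ν-step {p} {q} refl refl = begin
    (1ℚ + (1ℚ + a * q)) * ½ + ((1ℚ + (1ℚ - a * p) - (1ℚ + a * q)) * a) ÷ (2ℚ * (1ℚ + a))
      ≡⟨ cong (λ t → (1ℚ + (1ℚ + a * q)) * ½ + t) (÷-unique d≢0 second-term) ⟩
    (1ℚ + (1ℚ + a * q)) * ½ + a' * (1ℚ - a * p - a * q)
      ≡⟨ cong (λ t → (1ℚ + (1ℚ + t * q)) * ½ + a' * (1ℚ - a * p - a * q)) (sym scale) ⟩
    (1ℚ + (1ℚ + a' * (2ℚ * (1ℚ + a)) * q)) * ½ + a' * (1ℚ - a * p - a * q)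
      ≡⟨ collect a a' p q ⟩
    1ℚ + a' * (q + 1ℚ - a * p) ∎
    where
    open ≡-Reasoning
    second-term : a' * (1ℚ - a * p - a * q) * (2ℚ * (1ℚ + a)) ≡ (1ℚ + (1ℚ - a * p) - (1ℚ + a * q)) * a
    second-term = trans (descale (1ℚ - a * p - a * q)) (rearrange a p q)
      where
      rearrange : ∀ a p q → a * (1ℚ - a * p - a * q) ≡ (1ℚ + (1ℚ - a * p) - (1ℚ + a * q)) * a
      rearrange = solve-∀ ℚ-ring
    collect : ∀ a a' p q → (1ℚ + (1ℚ + a' * (2ℚ * (1ℚ + a)) * q)) * ½ + a' * (1ℚ - a * p - a * q)
                          ≡ 1ℚ + a' * (q + 1ℚ - a * p)
    collect = solve-∀ ℚ-ring

  admissible-step : ∀ {p q} → Admissible a p q → Admissible a' (p + 1ℚ - a * q) (q + 1ℚ - a * p)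
  admissible-step {p} {q} adm = record
    { q-nonneg = 0≤-via (q'-split a p q) (0≤+ q-nonneg ap≤1)
    ; gap      = 0≤-via (gap-split a p q) (0≤+ (0≤+ (0≤+ gap (0≤* 0≤a gap)) 0≤a) 0≤a)
    ; ap≤1     = 0≤-cancel d-pos (0≤-via (next-complement p q)
                   (0≤+ (0≤+ (0≤+ ap≤1 0≤1) 0≤a) (0≤* 0≤a (0≤* 0≤a q-nonneg))))
    }
    where
    open Admissible adm
    q'-split : ∀ a p q → q + 1ℚ - a * p ≡ q + (1ℚ - a * p)
    q'-split = solve-∀ ℚ-ring
    gap-split : ∀ a p q → (p + 1ℚ - a * q) - (q + 1ℚ - a * p) - 2ℚ
                          ≡ (p - q - 2ℚ) + a * (p - q - 2ℚ) + a + a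
    gap-split = solve-∀ ℚ-ring

next : ℚ → ℚ × ℚ → ℚ × ℚ
next a (p , q) = p + 1ℚ - a * q , q + 1ℚ - a * p

PQ : ℕ → ℚ × ℚ
PQ zero    = 2ℚ , 0ℚ
PQ (suc k) = next (α k) (PQ k)

P Q : ℕ → ℚ
P k = proj₁ (PQ k)
Q k = proj₂ (PQ k)

closed-form : ∀ k → γ k ≡ 1ℚ - α k * P k × ν k ≡ 1ℚ + α k * Q k
closed-form zero    = refl , refl
closed-form (suc k) = γ-step γk νk , ν-step γk νk
  where
  open Step {α k} {α (suc k)} (α-nonneg k) (α-scale k)
  γk : γ k ≡ 1ℚ - α k * P k
  γk = proj₁ (closed-form k)
  νk : ν k ≡ 1ℚ + α k * Q k
  νk = proj₂ (closed-form k)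

admissible : ∀ k → Admissible (α k) (P k) (Q k)
admissible zero    = record { q-nonneg = ≤-refl ; gap = ≤-refl ; ap≤1 = ≤-refl }
admissible (suc k) = Step.admissible-step {α k} {α (suc k)} (α-nonneg k) (α-scale k) (admissible k)

∈I-intro : ∀ k x → 1ℚ ÷ P k ≤ x → (0ℚ < Q k → x ≤ 1ℚ ÷ Q k) → x ∈I k
∈I-intro k x lower upper = subst (_≤ x) (sym left-end) lower , right-end
  where
  open Admissible (admissible k)
  γk : γ k ≡ 1ℚ - α k * P k
  γk = proj₁ (closed-form k)
  νk : ν k ≡ 1ℚ + α k * Q k
  νk = proj₂ (closed-form k)
  left-end : α k ÷ (1ℚ - γ k) ≡ 1ℚ ÷ P k
  left-end = ÷-scaled (α-pos k) (admissible-p-pos (admissible k))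
    (trans (cong (1ℚ -_) γk) (1-[1-x]≡x (α k * P k)))
    where
    1-[1-x]≡x : ∀ x → 1ℚ - (1ℚ - x) ≡ x
    1-[1-x]≡x = solve-∀ ℚ-ring
  right-end : ν k ≡ 1ℚ ⊎ x ≤ α k ÷ (ν k - 1ℚ)
  right-end with <-cmp 0ℚ (Q k)
  ... | tri< 0<q _ _ = inj₂ (subst (x ≤_) (sym (÷-scaled (α-pos k) 0<q
          (trans (cong (_- 1ℚ) νk) ([1+x]-1≡x (α k * Q k))))) (upper 0<q))
    where
    [1+x]-1≡x : ∀ x → (1ℚ + x) - 1ℚ ≡ x
    [1+x]-1≡x = solve-∀ ℚ-ring
  ... | tri≈ _ 0≡q _ = inj₁ (begin
    ν k              ≡⟨ νk ⟩
    1ℚ + α k * Q k   ≡⟨ cong (λ t → 1ℚ + α k * t) (sym 0≡q) ⟩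
    1ℚ + α k * 0ℚ    ≡⟨ cong (λ t → 1ℚ + t) (*-zeroʳ (α k)) ⟩
    1ℚ + 0ℚ          ≡⟨ +-identityʳ 1ℚ ⟩
    1ℚ ∎)
    where open ≡-Reasoning
  ... | tri> _ _ q<0 = ⊥-elim (<-irrefl refl (<-≤-trans q<0 q-nonneg))

lemma6p1 : (k : ℕ) → ∃[ x ] (x ∈I k × x ∈I suc k)
lemma6p1 k = 1ℚ ÷ P k , in-I , in-I'
  where
  adm : Admissible (α k) (P k) (Q k)
  adm = admissible k
  in-I : (1ℚ ÷ P k) ∈I k
  in-I = ∈I-intro k _ ≤-refl
    (λ 0<q → 1÷-antitone 0<q (admissible-q≤p adm))
  in-I' : (1ℚ ÷ P k) ∈I suc k
  in-I' = ∈I-intro (suc k) _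
    (1÷-antitone (admissible-p-pos adm) (admissible-p≤p' adm (α-nonneg k)))
    (λ 0<q' → 1÷-antitone 0<q' (admissible-q'≤p adm (α-nonneg k)))
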